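{- If $G$ is a finite simple graph with no isolated vertices, then $\iota(\mathrm{Mid}(G))\ge \frac{\gamma(G)}{2}$, where $\gamma(G)$ is the domination number of $G$.
   Context: For a graph $H$ and $S\subseteq V(H)$, let $N_H[S]$ be $S$ together with all vertices adjacent to a vertex of $S$. A set $S\subseteq V(H)$ is an isolating set of $H$ if $V(H)\setminus N_H[S]$ is an independent set of $H$; $\iota(H)$ is the minimum size of an isolating set of $H$. $\gamma(H)$ is the minimum size of a set $S$ with $N_H[S]=V(H)$. The middle graph $\mathrm{Mid}(G)$ has vertex set $V(G)\cup\{m_e: e\in E(G)\}$, with $v\sim m_e$ iff $v$ is an endpoint of $e$, $m_e\sim m_f$ iff distinct edges $e,f$ share an endpoint, and no edges between vertices of $V(G)$. -}

module Defs where

open import Data.Nat using (ℕ; _≤_)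
open import Data.Fin using (Fin) renaming (_<_ to _<ᶠ_)
open import Data.Bool using (Bool; true; false; T)
open import Data.Product using (Σ; _×_; _,_; ∃; ∃-syntax; proj₁; proj₂)
open import Data.Sum using (_⊎_; inj₁; inj₂)
open import Data.Empty using (⊥)
open import Data.List using (List; length)
open import Data.List.Membership.Propositional using (_∈_)
open import Data.List.Relation.Unary.Unique.Propositional using (Unique)
open import Relation.Nullary using (¬_)
open import Relation.Binary.PropositionalEquality using (_≡_; _≢_)

-- Generic notions for a graph given by a vertex type V and an
-- adjacency relation Adj.  Vertex sets are duplicate-free lists;
-- the size of a set is the length of the list.

InClosedNbhd : {V : Set} → (V → V → Set) → List V → V → Set
InClosedNbhd {V} Adj S x = x ∈ S ⊎ (∃[ s ] (s ∈ S × Adj s x))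

IsIsolatingSet : {V : Set} → (V → V → Set) → List V → Set
IsIsolatingSet {V} Adj S =
  (x y : V) → ¬ InClosedNbhd Adj S x → ¬ InClosedNbhd Adj S y → ¬ Adj x y

IsDominatingSet : {V : Set} → (V → V → Set) → List V → Set
IsDominatingSet {V} Adj S = (x : V) → InClosedNbhd Adj S x

IsMinSize : {V : Set} → (List V → Set) → ℕ → Set
IsMinSize {V} P k =
  (∃[ S ] (Unique S × P S × length S ≡ k)) ×
  ((S : List V) → Unique S → P S → k ≤ length S)

IsIsolationNumber : {V : Set} → (V → V → Set) → ℕ → Set
IsIsolationNumber Adj = IsMinSize (IsIsolatingSet Adj)

IsDominationNumber : {V : Set} → (V → V → Set) → ℕ → Set
IsDominationNumber Adj = IsMinSize (IsDominatingSet Adj)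

record SimpleGraph (n : ℕ) : Set where
  field
    adj   : Fin n → Fin n → Bool
    sym   : ∀ u v → adj u v ≡ adj v u
    loopless : ∀ v → adj v v ≡ false

module _ {n : ℕ} (G : SimpleGraph n) where
  open SimpleGraph G

  Adj : Fin n → Fin n → Set
  Adj u v = T (adj u v)

  NoIsolatedVertices : Set
  NoIsolatedVertices = (v : Fin n) → ∃[ w ] Adj v w

  -- an edge {u,v} is represented uniquely as (u , v) with u < v
  Edge : Set
  Edge = Σ (Fin n × Fin n) λ p → (proj₁ p <ᶠ proj₂ p) × Adj (proj₁ p) (proj₂ p)

  IsEndpoint : Fin n → Edge → Set
  IsEndpoint v e = (v ≡ proj₁ (proj₁ e)) ⊎ (v ≡ proj₂ (proj₁ e))

  ShareEndpoint : Edge → Edge → Set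
  ShareEndpoint e f = ∃[ v ] (IsEndpoint v e × IsEndpoint v f)

  MidVertex : Set
  MidVertex = Fin n ⊎ Edge

  MidAdj : MidVertex → MidVertex → Set
  MidAdj (inj₁ v) (inj₁ w) = ⊥
  MidAdj (inj₁ v) (inj₂ e) = IsEndpoint v e
  MidAdj (inj₂ e) (inj₁ v) = IsEndpoint v e
  MidAdj (inj₂ e) (inj₂ f) = e ≢ f × ShareEndpoint e f

-- An isolating set S of Mid(G) casts a "shadow" on V(G): its original vertices together with
-- both endpoints of its edge-vertices, at most 2|S| vertices in all.  The shadow dominates G:
-- a vertex x outside it with no neighbour in it has some neighbour y (G has no isolated
-- vertices), and then x and the edge-vertex m_xy are adjacent in Mid(G) yet both lie outside
-- N[S], contradicting that S is isolating.
module Submission where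

open import Defs
open import Data.Nat using (ℕ; _≤_; _*_; s≤s; z≤n)
open import Data.Nat.Properties using (≤-trans; *-suc; m≤n⇒m≤1+n)
open import Data.Fin using (Fin)
open import Data.Fin.Properties using (<-cmp) renaming (_≟_ to _≟ᶠ_)
open import Data.Bool using (T)
open import Data.Product using (Σ; _×_; _,_; proj₁)
open import Data.Sum using (_⊎_; inj₁; inj₂; swap)
open import Data.Empty using (⊥-elim)
open import Data.List using (List; []; _∷_; length; deduplicate)
open import Data.List.Properties using (length-deduplicate)
open import Data.List.Membership.Propositional using (_∈_)
open import Data.List.Membership.Propositional.Properties using (∈-deduplicate⁺)
open import Data.List.Relation.Unary.Any using (here; there)
open import Data.List.Relation.Unary.Unique.DecPropositional.Properties using (deduplicate-!)
open import Relation.Nullary using (¬_; yes; no)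
open import Relation.Binary using (DecidableEquality; tri<; tri≈; tri>)
open import Relation.Binary.PropositionalEquality using (_≡_; refl; subst)
import Data.List.Membership.DecPropositional as DecMembership

module _ {V : Set} (_≟_ : DecidableEquality V) {Adj : V → V → Set} where

  dominating-deduplicate : ∀ {S} → IsDominatingSet Adj S →
                           IsDominatingSet Adj (deduplicate _≟_ S)
  dominating-deduplicate dom x with dom x
  ... | inj₁ x∈S             = inj₁ (∈-deduplicate⁺ _≟_ x∈S)
  ... | inj₂ (s , s∈S , s~x) = inj₂ (s , ∈-deduplicate⁺ _≟_ s∈S , s~x)

  dominationNumber≤length : ∀ {g S} → IsDominationNumber Adj g →
                            IsDominatingSet Adj S → g ≤ length S
  dominationNumber≤length {S = S} (_ , minimal) dom =
    ≤-trans (minimal _ (deduplicate-! _≟_ S) (dominating-deduplicate dom))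
            (length-deduplicate _≟_ S)

module MiddleGraph {n : ℕ} (G : SimpleGraph n) where
  open SimpleGraph G using (loopless) renaming (sym to adj-sym)
  open DecMembership (_≟ᶠ_ {n}) using (_∈?_)

  shadow : List (MidVertex G) → List (Fin n)
  shadow []                       = []
  shadow (inj₁ v ∷ S)             = v ∷ shadow S
  shadow (inj₂ ((u , v) , _) ∷ S) = u ∷ v ∷ shadow S

  length-shadow : ∀ S → length (shadow S) ≤ 2 * length S
  length-shadow []           = z≤n
  length-shadow (inj₁ _ ∷ S) rewrite *-suc 2 (length S) = s≤s (m≤n⇒m≤1+n (length-shadow S))
  length-shadow (inj₂ _ ∷ S) rewrite *-suc 2 (length S) = s≤s (s≤s (length-shadow S))

  ∈-shadow-vertex : ∀ {x S} → inj₁ x ∈ S → x ∈ shadow S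
  ∈-shadow-vertex {S = inj₁ _ ∷ _} (here refl) = here refl
  ∈-shadow-vertex {S = inj₁ _ ∷ _} (there p)   = there (∈-shadow-vertex p)
  ∈-shadow-vertex {S = inj₂ _ ∷ _} (there p)   = there (there (∈-shadow-vertex p))

  ∈-shadow-endpoint : ∀ {x e S} → inj₂ e ∈ S → IsEndpoint G x e → x ∈ shadow S
  ∈-shadow-endpoint {S = inj₂ _ ∷ _} (here refl) (inj₁ refl) = here refl
  ∈-shadow-endpoint {S = inj₂ _ ∷ _} (here refl) (inj₂ refl) = there (here refl)
  ∈-shadow-endpoint {S = inj₁ _ ∷ _} (there p) x∈e = there (∈-shadow-endpoint p x∈e)
  ∈-shadow-endpoint {S = inj₂ _ ∷ _} (there p) x∈e = there (there (∈-shadow-endpoint p x∈e))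

  Joins : Fin n → Fin n → Edge G → Set
  Joins x y e = IsEndpoint G x e × IsEndpoint G y e ×
                (∀ w → IsEndpoint G w e → w ≡ x ⊎ w ≡ y)

  edgeJoining : ∀ x y → Adj G x y → Σ (Edge G) (Joins x y)
  edgeJoining x y x~y with <-cmp x y
  ... | tri< x<y _ _ = ((x , y) , x<y , x~y) , inj₁ refl , inj₂ refl , λ _ w∈e → w∈e
  ... | tri≈ _ refl _ = ⊥-elim (subst T (loopless x) x~y)
  ... | tri> _ _ y<x = ((y , x) , y<x , subst T (adj-sym x y) x~y) , inj₂ refl , inj₁ refl , λ _ → swap

  vertex∉closedNbhd : ∀ {x S} → ¬ x ∈ shadow S → ¬ InClosedNbhd (MidAdj G) S (inj₁ x)
  vertex∉closedNbhd x∉ (inj₁ x∈S)                  = x∉ (∈-shadow-vertex x∈S)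
  vertex∉closedNbhd x∉ (inj₂ (inj₂ f , f∈S , x∈f)) = x∉ (∈-shadow-endpoint f∈S x∈f)

  edge∉closedNbhd : ∀ {x y e S} → Joins x y e → ¬ x ∈ shadow S → ¬ y ∈ shadow S →
                    ¬ InClosedNbhd (MidAdj G) S (inj₂ e)
  edge∉closedNbhd {x} {y} {S = S} (x∈e , _ , only) x∉ y∉ = λ
    { (inj₁ e∈S)                                → x∉ (∈-shadow-endpoint e∈S x∈e)
    ; (inj₂ (inj₁ v , v∈S , v∈e))               → outside (only v v∈e) (∈-shadow-vertex v∈S)
    ; (inj₂ (inj₂ f , f∈S , _ , w , w∈f , w∈e)) → outside (only w w∈e) (∈-shadow-endpoint f∈S w∈f)
    }
    where
    outside : ∀ {w} → w ≡ x ⊎ w ≡ y → ¬ w ∈ shadow S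
    outside (inj₁ refl) = x∉
    outside (inj₂ refl) = y∉

  shadow-dominating : NoIsolatedVertices G → ∀ {S} → IsIsolatingSet (MidAdj G) S →
                      IsDominatingSet (Adj G) (shadow S)
  shadow-dominating noIsolated {S} isolating x with x ∈? shadow S
  ... | yes x∈ = inj₁ x∈
  ... | no x∉ with noIsolated x
  ... | y , x~y with y ∈? shadow S
  ... | yes y∈ = inj₂ (y , y∈ , subst T (adj-sym x y) x~y)
  ... | no y∉ with edgeJoining x y x~y
  ... | e , joins =
    ⊥-elim (isolating (inj₁ x) (inj₂ e) (vertex∉closedNbhd x∉) (edge∉closedNbhd joins x∉ y∉)
                      (proj₁ joins))

proposition3 : (n : ℕ) (G : SimpleGraph n) → NoIsolatedVertices G →
    (i g : ℕ) → IsIsolationNumber (MidAdj G) i → IsDominationNumber (Adj G) g →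
    g ≤ 2 * i
proposition3 n G noIsolated i g ((S , _ , isolating , refl) , _) γ≡g =
  ≤-trans (dominationNumber≤length _≟ᶠ_ γ≡g (shadow-dominating noIsolated isolating))
          (length-shadow S)
  where open MiddleGraph G
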